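{- Let $(b_n)_{n\ge 0}$ be the Catalan transform of the Catalan numbers $(C_n)_{n\ge 0}$, that is, $$b_n=\sum_{k=0}^{n}\frac{k}{2n-k}\binom{2n-k}{n-k}C_k ,$$ where the coefficient $\frac{k}{2n-k}\binom{2n-k}{n-k}$ is interpreted as $1$ when $n=k=0$, and $C_k=\frac{1}{k+1}\binom{2k}{k}$. Then for every nonnegative integer $n$, $b_n$ equals the number of functions $f:[1,n]\to[1,n]$ such that for all $1\le i<j\le n$, the integer $f(j)-(j-i)$ does not lie in the interval $[1,f(i)-1]$.
   Context: $[a,b]$ denotes the set of integers $m$ with $a\le m\le b$ (empty if $b<a$). The Catalan transform of a sequence $(a_n)_{n\ge0}$ is the sequence $(b_n)_{n\ge 0}$ with $b_n=\sum_{k=0}^{n}\frac{k}{2n-k}\binom{2n-k}{n-k}a_k$, the coefficient being $1$ when $n=k=0$. -}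

module Defs where

open import Data.Nat as ℕ using (ℕ; zero; suc)
open import Data.Nat.Combinatorics using (_C_)
open import Data.Integer as ℤ using (ℤ; +_)
import Data.Integer.Properties as ℤP
open import Data.Rational as ℚ using (ℚ; _/_; 0ℚ; 1ℚ)
open import Data.Fin as Fin using (Fin; toℕ)
open import Data.Fin.Properties using (all?)
import Data.Fin.Properties as FinP
import Data.Vec.Functional
open import Data.List using (List; []; _∷_; map; concatMap; filter; length)
open import Data.Product using (_×_)
open import Relation.Nullary using (Dec; ¬_; ¬?; _×-dec_; _→-dec_)

-- a / d in ℚ for natural numbers, with the value 0 when d = 0
-- (the d = 0 case never arises where this is used below, except n = k = 0,
--  which is handled separately)
ratioℕ : ℕ → ℕ → ℚ
ratioℕ a zero    = 0ℚ
ratioℕ a (suc d) = (+ a) / (suc d)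

catalan : ℕ → ℚ
catalan k = ratioℕ ((2 ℕ.* k) C k) (suc k)

catCoeff : ℕ → ℕ → ℚ
catCoeff zero zero = 1ℚ
catCoeff n k = ratioℕ (k ℕ.* ((2 ℕ.* n ℕ.∸ k) C (n ℕ.∸ k))) (2 ℕ.* n ℕ.∸ k)

sumTo : ℕ → (ℕ → ℚ) → ℚ
sumTo zero    g = g 0
sumTo (suc n) g = sumTo n g ℚ.+ g (suc n)

catalanTransform : (ℕ → ℚ) → ℕ → ℚ
catalanTransform a n = sumTo n (λ k → catCoeff n k ℚ.* a k)

b : ℕ → ℚ
b = catalanTransform catalan

-- Functions f : [1,n] → [1,n] are represented as Fin n → Fin n; the element
-- i : Fin n stands for the integer toℕ i + 1.
pos : ∀ {n} → Fin n → ℤ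
pos i = + (suc (toℕ i))

Good : ∀ n → (Fin n → Fin n) → Set
Good n f = ∀ (i j : Fin n) → i Fin.< j →
  ¬ ((+ 1 ℤ.≤ pos (f j) ℤ.- (pos j ℤ.- pos i)) ×
     (pos (f j) ℤ.- (pos j ℤ.- pos i) ℤ.≤ pos (f i) ℤ.- + 1))

good? : ∀ n (f : Fin n → Fin n) → Dec (Good n f)
good? n f = all? λ i → all? λ j → (i FinP.<? j) →-dec
  ¬? ((+ 1 ℤP.≤? pos (f j) ℤ.- (pos j ℤ.- pos i)) ×-dec
      (pos (f j) ℤ.- (pos j ℤ.- pos i) ℤP.≤? pos (f i) ℤ.- + 1))

-- List of all functions Fin m → Fin n (each exactly once, up to pointwise equality)
allFuns : ∀ m n → List (Fin m → Fin n)
allFuns zero    n = (λ ()) ∷ []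
allFuns (suc m) n =
  concatMap (λ v → map (λ g → v Data.Vec.Functional.∷ g) (allFuns m n)) (Data.List.allFin n)

countGood : ℕ → ℕ
countGood n = length (filter (good? n) (allFuns n n))

-- Read f from left to right. A value x at position i forbids, at position i + d, exactly
-- the values y with d ≤ y < x + d (0-based). So the values admissible at the next position form a
-- finite boolean list that is updated after each step, and the number of ways to complete a partial
-- function depends only on the length of that list and its number of admissible entries; this gives
-- a two-parameter recursion (completions). On the other side, k/(2n−k)·binom(2n−k, n−k) is the ballot
-- number ballot (n−k) k and C_k = ballot k 1; the convolution identity
-- ballot j (a+1) = Σ_m C_m · ballot (j−m) a shows that the Catalan transform satisfies the same recursion.
module Submission where

open import Data.Bool using (Bool; true; false; T; _∧_; if_then_else_)
open import Data.Bool.Properties using (T-∧; ∧-identityʳ; ∧-zeroʳ)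
open import Data.Fin as Fin using (Fin; toℕ)
import Data.Integer as ℤ
import Data.Integer.Properties as ℤP
import Data.Integer.Tactic.RingSolver as ℤ-Solver
open import Data.List using (List; []; _∷_; _++_; map; concatMap; filter; length; replicate; drop; tabulate)
open import Data.List.Properties using (length-replicate)
open import Data.List.Relation.Unary.All using (All; []; _∷_)
open import Data.Nat using (ℕ; zero; suc; _+_; _*_; _∸_; _≤_; _<_; _≤ᵇ_; z≤n; s≤s; s≤s⁻¹)
open import Data.Nat.Combinatorics using (_C_; k>n⇒nCk≡0; nCk+nC[k+1]≡[n+1]C[k+1]; nCk≡nC[n∸k])
open import Data.Nat.Properties
open import Data.Nat.Tactic.RingSolver using (solve-∀)
open import Data.Product using (_×_; _,_; proj₁; proj₂)
open import Data.Rational as ℚ using (ℚ; _/_)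
open import Data.Rational.Properties using (toℚᵘ-injective; toℚᵘ-fromℚᵘ; fromℚᵘ-cong; toℚᵘ-homo-+; toℚᵘ-homo-*)
open import Data.Rational.Unnormalised as ℚᵘ using (mkℚᵘ; *≡*)
import Data.Rational.Unnormalised.Properties as ℚᵘP
open import Data.Sum using (inj₁; inj₂)
open import Data.Unit using (tt)
import Data.Vec.Functional as Vector
open import Function using (_∘_; id)
open import Function.Bundles using (_⇔_; mk⇔; Equivalence)
open import Function.Construct.Composition using (_⇔-∘_)
open import Function.Construct.Symmetry using (⇔-sym)
open import Relation.Nullary using (¬_; does)
open import Relation.Nullary.Decidable using (T?; does-⇔)
open import Relation.Unary using (Decidable)
open import Relation.Binary.PropositionalEquality
open ≡-Reasoning

open import Algebra.Properties.CommutativeSemigroup +-commutativeSemigroup using (interchange; xy∙z≈xz∙y)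

open import Defs

∑ : ℕ → (ℕ → ℕ) → ℕ
∑ zero    f = 0
∑ (suc n) f = ∑ n f + f n

syntax ∑ n (λ i → e) = ∑[ i < n ] e

∑-cong : ∀ n {f g : ℕ → ℕ} → (∀ i → i < n → f i ≡ g i) → ∑ n f ≡ ∑ n g
∑-cong zero    eq = refl
∑-cong (suc n) eq = cong₂ _+_ (∑-cong n (λ i i<n → eq i (m<n⇒m<1+n i<n))) (eq n (n<1+n n))

∑-shift : ∀ n f → ∑ (suc n) f ≡ f 0 + ∑[ i < n ] f (suc i)
∑-shift zero    f = +-comm 0 (f 0)
∑-shift (suc n) f = begin
  ∑ (suc n) f + f (suc n)                ≡⟨ cong (_+ f (suc n)) (∑-shift n f) ⟩
  f 0 + ∑[ i < n ] f (suc i) + f (suc n) ≡⟨ +-assoc (f 0) _ _ ⟩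
  f 0 + ∑[ i < suc n ] f (suc i)         ∎

∑-distrib-+ : ∀ n f g → ∑[ i < n ] (f i + g i) ≡ ∑ n f + ∑ n g
∑-distrib-+ zero    f g = refl
∑-distrib-+ (suc n) f g = begin
  ∑[ i < n ] (f i + g i) + (f n + g n) ≡⟨ cong (_+ (f n + g n)) (∑-distrib-+ n f g) ⟩
  ∑ n f + ∑ n g + (f n + g n)          ≡⟨ interchange (∑ n f) (∑ n g) (f n) (g n) ⟩
  ∑ (suc n) f + ∑ (suc n) g            ∎

*-distribˡ-∑ : ∀ n c f → c * ∑ n f ≡ ∑[ i < n ] (c * f i)
*-distribˡ-∑ zero    c f = *-zeroʳ c
*-distribˡ-∑ (suc n) c f =
  trans (*-distribˡ-+ c (∑ n f) (f n)) (cong (_+ c * f n) (*-distribˡ-∑ n c f))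

∑-const : ∀ n k → ∑[ i < n ] k ≡ n * k
∑-const zero    k = refl
∑-const (suc n) k = trans (cong (_+ k) (∑-const n k)) (+-comm (n * k) k)

∑-zero : ∀ n → ∑[ i < n ] 0 ≡ 0
∑-zero n = trans (∑-const n 0) (*-zeroʳ n)

∑-comm : ∀ m n (f : ℕ → ℕ → ℕ) → ∑[ i < m ] ∑ n (f i) ≡ ∑[ j < n ] (∑[ i < m ] f i j)
∑-comm zero    n f = sym (∑-zero n)
∑-comm (suc m) n f = begin
  ∑[ i < m ] ∑ n (f i) + ∑ n (f m)        ≡⟨ cong (_+ ∑ n (f m)) (∑-comm m n f) ⟩
  ∑[ j < n ] (∑[ i < m ] f i j) + ∑ n (f m) ≡⟨ ∑-distrib-+ n _ _ ⟨
  ∑[ j < n ] (∑[ i < m ] f i j + f m j)    ∎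

∑-+ : ∀ m n f → ∑ (m + n) f ≡ ∑ m f + ∑[ i < n ] f (m + i)
∑-+ m zero    f = trans (cong (λ k → ∑ k f) (+-identityʳ m)) (sym (+-identityʳ _))
∑-+ m (suc n) f = begin
  ∑ (m + suc n) f                          ≡⟨ cong (λ k → ∑ k f) (+-suc m n) ⟩
  ∑ (m + n) f + f (m + n)                  ≡⟨ cong (_+ f (m + n)) (∑-+ m n f) ⟩
  ∑ m f + ∑[ i < n ] f (m + i) + f (m + n) ≡⟨ +-assoc (∑ m f) _ _ ⟩
  ∑ m f + ∑[ i < suc n ] f (m + i)         ∎

∑-reverse : ∀ n f → ∑[ i < n ] f (n ∸ suc i) ≡ ∑ n f
∑-reverse zero    f = refl
∑-reverse (suc n) f = begin
  ∑[ i < suc n ] f (n ∸ i)       ≡⟨ ∑-shift n _ ⟩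
  f n + ∑[ i < n ] f (n ∸ suc i) ≡⟨ cong (f n +_) (∑-reverse n f) ⟩
  f n + ∑ n f                    ≡⟨ +-comm (f n) _ ⟩
  ∑ (suc n) f                    ∎

∑-∸-reverse : ∀ c e f → c ≤ e → ∑[ i < e ] f (c ∸ i) ≡ ∑[ u < c ] f (suc u) + (e ∸ c) * f 0
∑-∸-reverse c e f c≤e = begin
  ∑ e g
    ≡⟨ cong (λ k → ∑ k g) (m+[n∸m]≡n c≤e) ⟨
  ∑ (c + (e ∸ c)) g
    ≡⟨ ∑-+ c (e ∸ c) g ⟩
  ∑ c g + ∑[ i < e ∸ c ] g (c + i)
    ≡⟨ cong₂ _+_ (∑-cong c λ i i<c → cong f (+-∸-assoc 1 i<c))
                 (∑-cong (e ∸ c) λ i _ → cong f (m≤n⇒m∸n≡0 (m≤m+n c i))) ⟩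
  ∑[ i < c ] f (suc (c ∸ suc i)) + ∑[ i < e ∸ c ] f 0
    ≡⟨ cong₂ _+_ (∑-reverse c (f ∘ suc)) (∑-const (e ∸ c) (f 0)) ⟩
  ∑[ u < c ] f (suc u) + (e ∸ c) * f 0 ∎
  where
  g = λ i → f (c ∸ i)

-- Ballot numbers

ballot : ℕ → ℕ → ℕ
ballot zero    m = 1
ballot (suc j) m = ∑[ t < m ] ballot j (2 + t)

catalanℕ : ℕ → ℕ
catalanℕ k = ballot k 1

ballotConv : ℕ → ℕ → ℕ
ballotConv j a = ∑[ m < suc j ] (catalanℕ m * ballot (j ∸ m) a)

ballotConv-suc : ∀ j a → ballotConv (suc j) a ≡
  ∑[ m < suc j ] (catalanℕ m * ballot (suc (j ∸ m)) a) + catalanℕ (suc j) * ballot 0 a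
ballotConv-suc j a = cong₂ _+_
  (∑-cong (suc j) λ m m<1+j → cong (λ k → catalanℕ m * ballot k a) (+-∸-assoc 1 (s≤s⁻¹ m<1+j)))
  (cong (λ k → catalanℕ (suc j) * ballot k a) (n∸n≡0 j))

ballotConv-zero : ∀ j → ballotConv (suc j) 0 ≡ catalanℕ (suc j)
ballotConv-zero j = begin
  ballotConv (suc j) 0                                           ≡⟨ ballotConv-suc j 0 ⟩
  ∑[ m < suc j ] (catalanℕ m * 0) + catalanℕ (suc j) * 1         ≡⟨ cong₂ _+_ vanish (*-identityʳ _) ⟩
  catalanℕ (suc j)                                               ∎
  where
  vanish : ∑[ m < suc j ] (catalanℕ m * 0) ≡ 0
  vanish = trans (∑-cong (suc j) (λ m _ → *-zeroʳ (catalanℕ m))) (∑-zero (suc j))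

ballotConv-recurrence : ∀ j a → ballotConv (suc j) (suc a) ≡ ballotConv (suc j) a + ballotConv j (2 + a)
ballotConv-recurrence j a = begin
  ballotConv (suc j) (suc a)                ≡⟨ ballotConv-suc j (suc a) ⟩
  ∑[ m < suc j ] (c m * ballot (suc (j ∸ m)) (suc a)) + c (suc j) * 1
    ≡⟨ cong (_+ c (suc j) * 1) (∑-cong (suc j) λ m _ → *-distribˡ-+ (c m) _ _) ⟩
  ∑[ m < suc j ] (c m * ballot (suc (j ∸ m)) a + c m * ballot (j ∸ m) (2 + a)) + c (suc j) * 1
    ≡⟨ cong (_+ c (suc j) * 1) (∑-distrib-+ (suc j) _ _) ⟩
  S + ballotConv j (2 + a) + c (suc j) * 1  ≡⟨ xy∙z≈xz∙y S _ _ ⟩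
  S + c (suc j) * 1 + ballotConv j (2 + a)  ≡⟨ cong (_+ ballotConv j (2 + a)) (ballotConv-suc j a) ⟨
  ballotConv (suc j) a + ballotConv j (2 + a) ∎
  where
  c = catalanℕ
  S = ∑[ m < suc j ] (c m * ballot (suc (j ∸ m)) a)

ballot-convolution : ∀ j a → ballot j (suc a) ≡ ballotConv j a
ballot-convolution zero    a       = refl
ballot-convolution (suc j) zero    = sym (ballotConv-zero j)
ballot-convolution (suc j) (suc a) = begin
  ballot (suc j) (suc a) + ballot j (3 + a)
    ≡⟨ cong₂ _+_ (ballot-convolution (suc j) a) (ballot-convolution j (2 + a)) ⟩
  ballotConv (suc j) a + ballotConv j (2 + a)
    ≡⟨ ballotConv-recurrence j a ⟨
  ballotConv (suc j) (suc a) ∎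

catalan-convolution : ∀ s → catalanℕ (suc s) ≡ ∑[ m < suc s ] (catalanℕ m * catalanℕ (s ∸ m))
catalan-convolution s = ballot-convolution s 1

binom : ℕ → ℕ → ℕ
binom n       zero    = 1
binom zero    (suc k) = 0
binom (suc n) (suc k) = binom n k + binom n (suc k)

C≡binom : ∀ n k → n C k ≡ binom n k
C≡binom n       zero    = refl
C≡binom zero    (suc k) = k>n⇒nCk≡0 {0} {suc k} (s≤s z≤n)
C≡binom (suc n) (suc k) =
  trans (sym (nCk+nC[k+1]≡[n+1]C[k+1] n k)) (cong₂ _+_ (C≡binom n k) (C≡binom n (suc k)))

binom-absorb : ∀ N i → suc i * binom (suc N) (suc i) ≡ suc N * binom N i
binom-absorb zero    zero    = refl
binom-absorb zero    (suc i) = *-zeroʳ (2 + i)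
binom-absorb (suc N) i = begin
  suc i * (binom (suc N) i + binom (suc N) (suc i))
    ≡⟨ *-distribˡ-+ (suc i) (binom (suc N) i) (binom (suc N) (suc i)) ⟩
  suc i * binom (suc N) i + suc i * binom (suc N) (suc i)
    ≡⟨ cong (suc i * binom (suc N) i +_) (binom-absorb N i) ⟩
  binom (suc N) i + i * binom (suc N) i + suc N * binom N i
    ≡⟨ +-assoc (binom (suc N) i) _ _ ⟩
  binom (suc N) i + (i * binom (suc N) i + suc N * binom N i)
    ≡⟨ cong (binom (suc N) i +_) (lower i) ⟩
  suc (suc N) * binom (suc N) i ∎
  where
  lower : ∀ i → i * binom (suc N) i + suc N * binom N i ≡ suc N * binom (suc N) i
  lower zero     = refl
  lower (suc i′) = begin
    suc i′ * binom (suc N) (suc i′) + suc N * binom N (suc i′)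
      ≡⟨ cong (_+ suc N * binom N (suc i′)) (binom-absorb N i′) ⟩
    suc N * binom N i′ + suc N * binom N (suc i′)
      ≡⟨ *-distribˡ-+ (suc N) (binom N i′) (binom N (suc i′)) ⟨
    suc N * binom (suc N) (suc i′) ∎

binom-middle-symmetric : ∀ k → binom (suc (k + k)) (suc k) ≡ binom (suc (k + k)) k
binom-middle-symmetric k = begin
  binom (suc (k + k)) (suc k)   ≡⟨ C≡binom (suc (k + k)) (suc k) ⟨
  suc (k + k) C suc k           ≡⟨ nCk≡nC[n∸k] (s≤s (m≤m+n k k)) ⟩
  suc (k + k) C (k + k ∸ k)     ≡⟨ cong (suc (k + k) C_) (m+n∸n≡m k k) ⟩
  suc (k + k) C k               ≡⟨ C≡binom (suc (k + k)) k ⟩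
  binom (suc (k + k)) k         ∎

ballot-closed-form-step : ∀ i m →
  (suc i + suc i + m) * ballot (suc i) m ≡ m * binom (suc i + suc i + m) (suc i) →
  (i + i + (2 + m)) * ballot i (2 + m) ≡ (2 + m) * binom (i + i + (2 + m)) i →
  (suc i + suc i + suc m) * ballot (suc i) (suc m) ≡ suc m * binom (suc i + suc i + suc m) (suc i)
ballot-closed-form-step i m IH-p IH-q′ = begin
  (suc i + suc i + suc m) * (p + q) ≡⟨ cong (_* (p + q)) (+-suc (suc i + suc i) m) ⟩
  suc K * (p + q)                   ≡⟨ *-cancelˡ-≡ _ _ K scaled ⟩
  suc m * (x + y)                   ≡⟨ cong (λ N → suc m * binom N (suc i)) (+-suc (suc i + suc i) m) ⟨
  suc m * binom (suc i + suc i + suc m) (suc i) ∎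
  where
  K = suc i + suc i + m
  p = ballot (suc i) m
  q = ballot i (2 + m)
  x = binom K i
  y = binom K (suc i)
  IH-q : K * q ≡ (2 + m) * x
  IH-q = subst (λ N → N * q ≡ (2 + m) * binom N i) (reassoc i m) IH-q′
    where reassoc : ∀ i m → i + i + (2 + m) ≡ suc i + suc i + m
          reassoc = solve-∀
  -- the defect of the target identity is a multiple of the absorption identity for (K, i)
  balance : ∀ i m x y →
    suc (suc i + suc i + m) * (m * y + (2 + m) * x) + 2 * (suc i * (x + y))
      ≡ (suc i + suc i + m) * (suc m * (x + y)) + 2 * (suc (suc i + suc i + m) * x)
  balance = solve-∀
  target : suc K * (m * y + (2 + m) * x) ≡ K * (suc m * (x + y))
  target = +-cancelʳ-≡ (2 * (suc K * x)) _ _ (begin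
    suc K * (m * y + (2 + m) * x) + 2 * (suc K * x)
      ≡⟨ cong (λ z → suc K * (m * y + (2 + m) * x) + 2 * z) (binom-absorb K i) ⟨
    suc K * (m * y + (2 + m) * x) + 2 * (suc i * (x + y))
      ≡⟨ balance i m x y ⟩
    K * (suc m * (x + y)) + 2 * (suc K * x) ∎)
  expand : ∀ K p q → K * (suc K * (p + q)) ≡ suc K * (K * p + K * q)
  expand = solve-∀
  scaled : K * (suc K * (p + q)) ≡ K * (suc m * (x + y))
  scaled = begin
    K * (suc K * (p + q))         ≡⟨ expand K p q ⟩
    suc K * (K * p + K * q)       ≡⟨ cong (λ z → suc K * z) (cong₂ _+_ IH-p IH-q) ⟩
    suc K * (m * y + (2 + m) * x) ≡⟨ target ⟩
    K * (suc m * (x + y))         ∎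

ballot-closed-form : ∀ j m → (j + j + m) * ballot j m ≡ m * binom (j + j + m) j
ballot-closed-form zero    m       = refl
ballot-closed-form (suc i) zero    = *-zeroʳ (suc i + suc i + 0)
ballot-closed-form (suc i) (suc m) =
  ballot-closed-form-step i m (ballot-closed-form (suc i) m) (ballot-closed-form i (2 + m))

central-binom : ∀ k → binom (k + k) k ≡ suc k * catalanℕ k
central-binom k = *-cancelˡ-≡ _ _ (suc (k + k)) (begin
  suc (k + k) * binom (k + k) k        ≡⟨ binom-absorb (k + k) k ⟨
  suc k * binom (suc (k + k)) (suc k)  ≡⟨ cong (suc k *_) (binom-middle-symmetric k) ⟩
  suc k * binom (suc (k + k)) k        ≡⟨ cong (suc k *_) closed ⟨
  suc k * (suc (k + k) * catalanℕ k)   ≡⟨ *-comm-left (suc k) (suc (k + k)) (catalanℕ k) ⟩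
  suc (k + k) * (suc k * catalanℕ k)   ∎)
  where
  closed : suc (k + k) * catalanℕ k ≡ binom (suc (k + k)) k
  closed = subst (λ N → N * catalanℕ k ≡ binom N k) (+-comm (k + k) 1)
                 (trans (ballot-closed-form k 1) (*-identityˡ _))
  *-comm-left : ∀ a c d → a * (c * d) ≡ c * (a * d)
  *-comm-left = solve-∀

-- The Catalan transform as a natural number

fromℕ : ℕ → ℚ
fromℕ a = ℤ.+ a / 1

toℚᵘ-fromℕ : ∀ a → ℚ.toℚᵘ (fromℕ a) ℚᵘ.≃ mkℚᵘ (ℤ.+ a) 0
toℚᵘ-fromℕ a = toℚᵘ-fromℚᵘ (mkℚᵘ (ℤ.+ a) 0)

fromℕ-+ : ∀ a c → fromℕ a ℚ.+ fromℕ c ≡ fromℕ (a + c)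
fromℕ-+ a c = toℚᵘ-injective (ℚᵘP.≃-trans (toℚᵘ-homo-+ (fromℕ a) (fromℕ c))
  (ℚᵘP.≃-trans (ℚᵘP.+-cong (toℚᵘ-fromℕ a) (toℚᵘ-fromℕ c))
  (ℚᵘP.≃-trans (*≡* (cong (ℤ._* ℤ.+ 1) sum)) (ℚᵘP.≃-sym (toℚᵘ-fromℕ (a + c))))))
  where
  sum : ℤ.+ a ℤ.* ℤ.+ 1 ℤ.+ ℤ.+ c ℤ.* ℤ.+ 1 ≡ ℤ.+ (a + c)
  sum = trans (cong₂ ℤ._+_ (ℤP.*-identityʳ (ℤ.+ a)) (ℤP.*-identityʳ (ℤ.+ c))) (sym (ℤP.pos-+ a c))

fromℕ-* : ∀ a c → fromℕ a ℚ.* fromℕ c ≡ fromℕ (a * c)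
fromℕ-* a c = toℚᵘ-injective (ℚᵘP.≃-trans (toℚᵘ-homo-* (fromℕ a) (fromℕ c))
  (ℚᵘP.≃-trans (ℚᵘP.*-cong (toℚᵘ-fromℕ a) (toℚᵘ-fromℕ c))
  (ℚᵘP.≃-trans (*≡* (cong (ℤ._* ℤ.+ 1) (sym (ℤP.pos-* a c)))) (ℚᵘP.≃-sym (toℚᵘ-fromℕ (a * c))))))

ratioℕ≡fromℕ : ∀ {a d} x → 0 < d → a ≡ d * x → ratioℕ a d ≡ fromℕ x
ratioℕ≡fromℕ {a} {suc d} x _ a≡ = fromℚᵘ-cong {mkℚᵘ (ℤ.+ a) d} {mkℚᵘ (ℤ.+ x) 0} (*≡* (begin
  ℤ.+ a ℤ.* ℤ.+ 1     ≡⟨ ℤP.pos-* a 1 ⟨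
  ℤ.+ (a * 1)         ≡⟨ cong ℤ.+_ (trans (*-identityʳ a) (trans a≡ (*-comm (suc d) x))) ⟩
  ℤ.+ (x * suc d)     ≡⟨ ℤP.pos-* x (suc d) ⟩
  ℤ.+ x ℤ.* ℤ.+ suc d ∎))

catalan≡fromℕ : ∀ k → catalan k ≡ fromℕ (catalanℕ k)
catalan≡fromℕ k = ratioℕ≡fromℕ (catalanℕ k) (s≤s z≤n) (begin
  (2 * k) C k       ≡⟨ C≡binom (2 * k) k ⟩
  binom (2 * k) k   ≡⟨ cong (λ N → binom (k + N) k) (+-identityʳ k) ⟩
  binom (k + k) k   ≡⟨ central-binom k ⟩
  suc k * catalanℕ k ∎)

catCoeff≡fromℕ : ∀ n k → k ≤ n → catCoeff n k ≡ fromℕ (ballot (n ∸ k) k)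
catCoeff≡fromℕ zero     zero _   = refl
catCoeff≡fromℕ (suc n′) k    k≤n = ratioℕ≡fromℕ (ballot j k) 0<D (begin
  k * ((2 * n ∸ k) C j)      ≡⟨ cong (λ N → k * (N C j)) D≡ ⟩
  k * ((j + j + k) C j)      ≡⟨ cong (k *_) (C≡binom (j + j + k) j) ⟩
  k * binom (j + j + k) j    ≡⟨ ballot-closed-form j k ⟨
  (j + j + k) * ballot j k   ≡⟨ cong (_* ballot j k) D≡ ⟨
  (2 * n ∸ k) * ballot j k   ∎)
  where
  n = suc n′
  j = n ∸ k
  D≡ : 2 * n ∸ k ≡ j + j + k
  D≡ = begin
    2 * n ∸ k           ≡⟨ cong (λ N → 2 * N ∸ k) (m∸n+n≡m k≤n) ⟨
    2 * (j + k) ∸ k     ≡⟨ cong (_∸ k) (double j k) ⟩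
    j + j + k + k ∸ k   ≡⟨ m+n∸n≡m (j + j + k) k ⟩
    j + j + k           ∎
    where double : ∀ j k → 2 * (j + k) ≡ j + j + k + k
          double = solve-∀
  0<D : 0 < 2 * n ∸ k
  0<D = m<n⇒0<n∸m (≤-<-trans k≤n (m<m+n n (s≤s z≤n)))

bℕ : ℕ → ℕ
bℕ n = ∑[ m < suc n ] (catalanℕ m * ballot (n ∸ m) m)

sumTo≡fromℕ : ∀ n g G → (∀ k → k ≤ n → g k ≡ fromℕ (G k)) → sumTo n g ≡ fromℕ (∑ (suc n) G)
sumTo≡fromℕ zero    g G eq = eq 0 z≤n
sumTo≡fromℕ (suc n) g G eq = trans
  (cong₂ ℚ._+_ (sumTo≡fromℕ n g G (λ k k≤n → eq k (m≤n⇒m≤1+n k≤n))) (eq (suc n) ≤-refl))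
  (fromℕ-+ (∑ (suc n) G) (G (suc n)))

b≡fromℕ : ∀ n → b n ≡ fromℕ (bℕ n)
b≡fromℕ n = trans
  (sumTo≡fromℕ n _ (λ k → ballot (n ∸ k) k * catalanℕ k) λ k k≤n →
     trans (cong₂ ℚ._*_ (catCoeff≡fromℕ n k k≤n) (catalan≡fromℕ k)) (fromℕ-* (ballot (n ∸ k) k) (catalanℕ k)))
  (cong fromℕ (∑-cong (suc n) λ k _ → *-comm (ballot (n ∸ k) k) (catalanℕ k)))

-- The completion recursion

-- The number of ways to fill r more positions from a state with h admissible listed values
-- and e further values beyond the list.
completions : ℕ → ℕ → ℕ → ℕ
completions zero    e h = 1
completions (suc r) e h = ∑[ t < e ] completions r t 1 + ∑[ t < h ] completions r (e ∸ 1) (2 + t)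

shiftedConv : ℕ → ℕ → ℕ → ℕ
shiftedConv r δ h = ∑[ m < suc r ] (catalanℕ m * ballot (r ∸ m) (h + (m ∸ δ)))

ballot-prefix-sum : ∀ j c h →
  ∑[ u < c ] ballot j (suc u) + ∑[ t < suc h ] ballot j (suc t + c) ≡ ballot (suc j) (h + c) + catalanℕ j
ballot-prefix-sum j c h = begin
  ∑ c F + ∑[ t < suc h ] ballot j (suc t + c) ≡⟨ cong (∑ c F +_) (∑-cong (suc h) λ t _ → cong F (+-comm t c)) ⟩
  ∑ c F + ∑[ t < suc h ] F (c + t)            ≡⟨ ∑-+ c (suc h) F ⟨
  ∑ (c + suc h) F                             ≡⟨ cong (λ k → ∑ k F) (+-suc c h) ⟩
  ∑ (suc (c + h)) F                           ≡⟨ ∑-shift (c + h) F ⟩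
  catalanℕ j + ballot (suc j) (c + h)         ≡⟨ +-comm (catalanℕ j) _ ⟩
  ballot (suc j) (c + h) + catalanℕ j         ≡⟨ cong (λ k → ballot (suc j) k + catalanℕ j) (+-comm c h) ⟩
  ballot (suc j) (h + c) + catalanℕ j         ∎
  where F = λ u → ballot j (suc u)

ballot-reversed-sum : ∀ s e δ m → e + δ ≡ suc s → m ≤ suc s →
  ∑[ t < e ] ballot (suc s ∸ m) (m ∸ (s ∸ t)) ≡ ∑[ u < m ∸ δ ] ballot (suc s ∸ m) (suc u)
ballot-reversed-sum s e δ m e+δ≡ m≤ = begin
  ∑[ t < e ] ballot j (m ∸ (s ∸ t))
    ≡⟨ ∑-reverse e _ ⟨
  ∑[ i < e ] ballot j (m ∸ (s ∸ (e ∸ suc i)))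
    ≡⟨ ∑-cong e (λ i i<e → cong (λ k → ballot j (m ∸ k)) (distance i i<e)) ⟩
  ∑[ i < e ] ballot j (m ∸ (δ + i))
    ≡⟨ ∑-cong e (λ i _ → cong (ballot j) (∸-+-assoc m δ i)) ⟨
  ∑[ i < e ] ballot j (c ∸ i)
    ≡⟨ ∑-∸-reverse c e (ballot j) c≤e ⟩
  ∑[ u < c ] ballot j (suc u) + (e ∸ c) * ballot j 0
    ≡⟨ cong (∑[ u < c ] ballot j (suc u) +_) vanish ⟩
  ∑[ u < c ] ballot j (suc u) + 0
    ≡⟨ +-identityʳ _ ⟩
  ∑[ u < c ] ballot j (suc u) ∎
  where
  j = suc s ∸ m
  c = m ∸ δ
  e≡ : suc s ∸ δ ≡ e
  e≡ = trans (cong (_∸ δ) (sym e+δ≡)) (m+n∸n≡m e δ)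
  c≤e : c ≤ e
  c≤e = subst (c ≤_) e≡ (∸-monoˡ-≤ δ m≤)
  distance : ∀ i → i < e → s ∸ (e ∸ suc i) ≡ δ + i
  distance i i<e = trans (cong (_∸ k) s≡) (m+n∸m≡n k (δ + i))
    where
    k = e ∸ suc i
    rearrange : ∀ k i δ → k + suc i + δ ≡ suc (k + (δ + i))
    rearrange = solve-∀
    s≡ : s ≡ k + (δ + i)
    s≡ = suc-injective (trans (sym e+δ≡) (trans (cong (_+ δ) (sym (m∸n+n≡m i<e))) (rearrange k i δ)))
  -- either j > 0 and ballot j 0 = 0, or m = s + 1 and then c = e
  vanish : (e ∸ c) * ballot j 0 ≡ 0
  vanish with m≤n⇒m<n∨m≡n m≤
  ... | inj₁ m≤s  = trans (cong (λ k → (e ∸ c) * ballot k 0) (+-∸-assoc 1 (s≤s⁻¹ m≤s))) (*-zeroʳ (e ∸ c))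
  ... | inj₂ refl = cong₂ _*_ (trans (cong (e ∸_) e≡) (n∸n≡0 e)) (cong (λ k → ballot k 0) (n∸n≡0 s))

shiftedConv-suc-δ : ∀ s h → shiftedConv (suc s) s h ≡ shiftedConv (suc s) (suc s) h
shiftedConv-suc-δ s h = ∑-cong (suc (suc s)) same
  where
  same : ∀ m → m < suc (suc s) →
         catalanℕ m * ballot (suc s ∸ m) (h + (m ∸ s)) ≡ catalanℕ m * ballot (suc s ∸ m) (h + (m ∸ suc s))
  same m m<2+s with m≤n⇒m<n∨m≡n (s≤s⁻¹ m<2+s)
  ... | inj₁ m≤s  = cong (λ k → catalanℕ m * ballot (suc s ∸ m) (h + k))
                         (trans (m≤n⇒m∸n≡0 (s≤s⁻¹ m≤s)) (sym (m≤n⇒m∸n≡0 (s≤s⁻¹ m<2+s))))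
  ... | inj₂ refl = trans (cong (λ j → catalanℕ (suc s) * ballot j (h + (suc s ∸ s))) (n∸n≡0 s))
                          (cong (λ j → catalanℕ (suc s) * ballot j (h + (s ∸ s))) (sym (n∸n≡0 s)))

completions-step : ∀ s →
  (∀ e δ h → e + δ ≡ s → completions (suc s) e (suc h) ≡ shiftedConv (suc s) δ h) →
  ∀ e δ h → e + δ ≡ suc s → completions (suc (suc s)) e (suc h) ≡ shiftedConv (suc (suc s)) δ h
completions-step s IH e δ h e+δ≡ = begin
  ∑[ t < e ] completions (suc s) t 1 + ∑[ t < suc h ] completions (suc s) (e ∸ 1) (2 + t)
    ≡⟨ cong₂ _+_ (∑-cong e fresh) (∑-cong (suc h) (reused e e+δ≡)) ⟩
  ∑[ t < e ] shiftedConv (suc s) (s ∸ t) 0 + ∑[ t < suc h ] shiftedConv (suc s) δ (suc t)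
    ≡⟨ cong₂ _+_ (∑-comm e M _) (∑-comm (suc h) M _) ⟩
  ∑[ m < M ] (∑[ t < e ] (c m * A t m)) + ∑[ m < M ] (∑[ t < suc h ] (c m * B t m))
    ≡⟨ ∑-distrib-+ M _ _ ⟨
  ∑[ m < M ] (∑[ t < e ] (c m * A t m) + ∑[ t < suc h ] (c m * B t m))
    ≡⟨ ∑-cong M (λ m m<M → per-summand m (s≤s⁻¹ m<M)) ⟩
  ∑[ m < M ] (c m * ballot (suc (j m)) (h + (m ∸ δ)) + c m * c (j m))
    ≡⟨ ∑-distrib-+ M _ _ ⟩
  ∑[ m < M ] (c m * ballot (suc (j m)) (h + (m ∸ δ))) + ∑[ m < M ] (c m * c (j m))
    ≡⟨ cong₂ _+_ (∑-cong M λ m m<M → cong (λ k → c m * ballot k (h + (m ∸ δ))) (+-∸-assoc 1 (s≤s⁻¹ m<M)))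
                 (catalan-convolution (suc s)) ⟨
  ∑[ m < M ] (c m * ballot (suc (suc s) ∸ m) (h + (m ∸ δ))) + c M
    ≡⟨ cong (∑[ m < M ] (c m * ballot (suc (suc s) ∸ m) (h + (m ∸ δ))) +_) last ⟩
  shiftedConv (suc (suc s)) δ h ∎
  where
  M = suc (suc s)
  c = catalanℕ
  j = λ m → suc s ∸ m
  A = λ t m → ballot (j m) (m ∸ (s ∸ t))
  B = λ t m → ballot (j m) (suc t + (m ∸ δ))
  e≤ : e ≤ suc s
  e≤ = subst (e ≤_) e+δ≡ (m≤m+n e δ)
  fresh : ∀ t → t < e → completions (suc s) t 1 ≡ shiftedConv (suc s) (s ∸ t) 0
  fresh t t<e = IH t (s ∸ t) 0 (m+[n∸m]≡n (s≤s⁻¹ (≤-trans t<e e≤)))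
  reused : ∀ e → e + δ ≡ suc s → ∀ t → t < suc h →
           completions (suc s) (e ∸ 1) (2 + t) ≡ shiftedConv (suc s) δ (suc t)
  reused (suc e′) e+δ≡ t _ = IH e′ δ (suc t) (suc-injective e+δ≡)
  reused zero     refl t _ = trans (IH 0 s (suc t) refl) (shiftedConv-suc-δ s (suc t))
  per-summand : ∀ m → m ≤ suc s →
    ∑[ t < e ] (c m * A t m) + ∑[ t < suc h ] (c m * B t m) ≡ c m * ballot (suc (j m)) (h + (m ∸ δ)) + c m * c (j m)
  per-summand m m≤ = begin
    ∑[ t < e ] (c m * A t m) + ∑[ t < suc h ] (c m * B t m)
      ≡⟨ cong₂ _+_ (*-distribˡ-∑ e (c m) _) (*-distribˡ-∑ (suc h) (c m) _) ⟨
    c m * ∑[ t < e ] A t m + c m * ∑[ t < suc h ] B t m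
      ≡⟨ *-distribˡ-+ (c m) _ _ ⟨
    c m * (∑[ t < e ] A t m + ∑[ t < suc h ] B t m)
      ≡⟨ cong (λ z → c m * (z + ∑[ t < suc h ] B t m)) (ballot-reversed-sum s e δ m e+δ≡ m≤) ⟩
    c m * (∑[ u < m ∸ δ ] ballot (j m) (suc u) + ∑[ t < suc h ] B t m)
      ≡⟨ cong (c m *_) (ballot-prefix-sum (j m) (m ∸ δ) h) ⟩
    c m * (ballot (suc (j m)) (h + (m ∸ δ)) + c (j m))
      ≡⟨ *-distribˡ-+ (c m) _ _ ⟩
    c m * ballot (suc (j m)) (h + (m ∸ δ)) + c m * c (j m) ∎
  last : c M ≡ c M * ballot (suc (suc s) ∸ M) (h + (M ∸ δ))
  last = sym (trans (cong (λ k → c M * ballot k (h + (M ∸ δ))) (n∸n≡0 s)) (*-identityʳ (c M)))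

completions≡shiftedConv : ∀ s e δ h → e + δ ≡ s → completions (suc s) e (suc h) ≡ shiftedConv (suc s) δ h
completions≡shiftedConv zero    zero zero h refl =
  trans (cong (λ k → ∑[ t < k ] 1 + 1) (sym (+-identityʳ h))) (cong (_+ 1) (sym (+-identityʳ _)))
completions≡shiftedConv (suc s) = completions-step s (completions≡shiftedConv s)

completions≡bℕ : ∀ n → completions n (n ∸ 1) 1 ≡ bℕ n
completions≡bℕ zero    = refl
completions≡bℕ (suc s) = completions≡shiftedConv s s 0 0 (+-identityʳ s)

-- Counting admissible functions

count : {A : Set} → (A → Bool) → List A → ℕ
count p []       = 0
count p (x ∷ xs) = (if p x then 1 else 0) + count p xs

length-filter : ∀ {A : Set} {P : A → Set} (P? : Decidable P) xs → length (filter P? xs) ≡ count (does ∘ P?) xs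
length-filter P? []       = refl
length-filter P? (x ∷ xs) with does (P? x)
... | true  = cong suc (length-filter P? xs)
... | false = length-filter P? xs

count-++ : ∀ {A : Set} (p : A → Bool) xs ys → count p (xs ++ ys) ≡ count p xs + count p ys
count-++ p []       ys = refl
count-++ p (x ∷ xs) ys = trans (cong (_ +_) (count-++ p xs ys)) (sym (+-assoc (if p x then 1 else 0) _ _))

count-map : ∀ {A B : Set} (p : B → Bool) (h : A → B) xs → count p (map h xs) ≡ count (p ∘ h) xs
count-map p h []       = refl
count-map p h (x ∷ xs) = cong (_ +_) (count-map p h xs)

count-cong : ∀ {A : Set} {p q : A → Bool} → (∀ x → p x ≡ q x) → ∀ xs → count p xs ≡ count q xs
count-cong p≡q []       = refl
count-cong p≡q (x ∷ xs) = cong₂ (λ b c → (if b then 1 else 0) + c) (p≡q x) (count-cong p≡q xs)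

count-false : ∀ {A : Set} (xs : List A) → count (λ _ → false) xs ≡ 0
count-false []       = refl
count-false (x ∷ xs) = count-false xs

count-∧ : ∀ {A : Set} b (p : A → Bool) xs → count (λ x → b ∧ p x) xs ≡ (if b then count p xs else 0)
count-∧ true  p xs = refl
count-∧ false p xs = count-false xs

count-concatMap-tabulate : ∀ {A B : Set} (p : B → Bool) (h : A → List B) (H : ℕ → ℕ) m (e : Fin m → A) →
  (∀ i → count p (h (e i)) ≡ H (toℕ i)) → count p (concatMap h (tabulate e)) ≡ ∑ m H
count-concatMap-tabulate p h H zero    e eq = refl
count-concatMap-tabulate p h H (suc m) e eq = begin
  count p (h (e Fin.zero) ++ concatMap h (tabulate (e ∘ Fin.suc)))
    ≡⟨ count-++ p (h (e Fin.zero)) _ ⟩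
  count p (h (e Fin.zero)) + count p (concatMap h (tabulate (e ∘ Fin.suc)))
    ≡⟨ cong₂ _+_ (eq Fin.zero) (count-concatMap-tabulate p h (H ∘ suc) m (e ∘ Fin.suc) (eq ∘ Fin.suc)) ⟩
  H 0 + ∑[ i < m ] H (suc i)
    ≡⟨ ∑-shift m H ⟨
  ∑ (suc m) H ∎

-- A state X lists, for each value w < length X, whether w is admissible at the current position;
-- larger values are admissible. Placing v makes the forbidden set at the next position
-- {1, …, v} ∪ (old forbidden set + 1).
allowed : List Bool → ℕ → Bool
allowed []      w       = true
allowed (x ∷ X) zero    = x
allowed (x ∷ X) (suc w) = allowed X w

forbidBelow : List Bool → ℕ → List Bool
forbidBelow []      v       = replicate v false
forbidBelow (x ∷ X) zero    = x ∷ X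
forbidBelow (x ∷ X) (suc v) = false ∷ forbidBelow X v

advance : List Bool → ℕ → List Bool
advance X v = true ∷ forbidBelow X v

accepts : ∀ {n} r → List Bool → (Fin r → Fin n) → Bool
accepts zero    X g = true
accepts (suc r) X g = allowed X (toℕ (g Fin.zero)) ∧ accepts r (advance X (toℕ (g Fin.zero))) (g ∘ Fin.suc)

acceptCount : ℕ → List Bool → ℕ → ℕ
acceptCount n X r = count (accepts r X) (allFuns r n)

acceptCount-suc : ∀ n X r →
  acceptCount n X (suc r) ≡ ∑[ v < n ] (if allowed X v then acceptCount n (advance X v) r else 0)
acceptCount-suc n X r = count-concatMap-tabulate (accepts (suc r) X) (λ v → map (v Vector.∷_) (allFuns r n)) _ n id
  λ v → begin
    count (accepts (suc r) X) (map (v Vector.∷_) (allFuns r n))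
      ≡⟨ count-map (accepts (suc r) X) (v Vector.∷_) (allFuns r n) ⟩
    count (λ g → allowed X (toℕ v) ∧ accepts r (advance X (toℕ v)) g) (allFuns r n)
      ≡⟨ count-∧ (allowed X (toℕ v)) (accepts r (advance X (toℕ v))) (allFuns r n) ⟩
    (if allowed X (toℕ v) then acceptCount n (advance X (toℕ v)) r else 0) ∎

FalseFrom : ℕ → List Bool → Set
FalseFrom k X = All (_≡ false) (drop k X)

FalseFrom-replicate : ∀ k v → FalseFrom k (replicate v false)
FalseFrom-replicate zero    zero    = []
FalseFrom-replicate (suc k) zero    = []
FalseFrom-replicate zero    (suc v) = refl ∷ FalseFrom-replicate zero v
FalseFrom-replicate (suc k) (suc v) = FalseFrom-replicate k v

FalseFrom-forbidBelow : ∀ k X v → FalseFrom k X → FalseFrom k (forbidBelow X v)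
FalseFrom-forbidBelow k       []      v       _              = FalseFrom-replicate k v
FalseFrom-forbidBelow k       (x ∷ X) zero    all            = all
FalseFrom-forbidBelow zero    (x ∷ X) (suc v) (_ ∷ all)      = refl ∷ FalseFrom-forbidBelow zero X v all
FalseFrom-forbidBelow (suc k) (x ∷ X) (suc v) all            = FalseFrom-forbidBelow k X v all

count-FalseFrom-zero : ∀ X → FalseFrom 0 X → count id X ≡ 0
count-FalseFrom-zero []          []           = refl
count-FalseFrom-zero (false ∷ X) (_ ∷ all)    = count-FalseFrom-zero X all

-- For v ≥ length X, forbidBelow X v has length v and no admissible entry; for the admissible
-- v < length X, in increasing order, it keeps length X and h, h − 1, …, 1 admissible entries.
successorSum : (ℕ → ℕ → ℕ) → List Bool → ℕ → ℕ
successorSum Q X N =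
  ∑[ v < N ] (if allowed X v then Q (length (forbidBelow X v)) (count id (forbidBelow X v)) else 0)

groupedSum : (ℕ → ℕ → ℕ) → List Bool → ℕ → ℕ
groupedSum Q X N = ∑[ t < N ∸ length X ] Q (length X + t) 0 + ∑[ t < count id X ] Q (length X) (suc t)

successorSum-∷ : ∀ Q x X N → successorSum (Q ∘ suc) X N ≡ groupedSum (Q ∘ suc) X N →
                 successorSum Q (x ∷ X) (suc N) ≡ groupedSum Q (x ∷ X) (suc N)
successorSum-∷ Q false X N IH = trans (∑-shift N _) IH
successorSum-∷ Q true  X N IH = begin
  successorSum Q (true ∷ X) (suc N)    ≡⟨ ∑-shift N _ ⟩
  new + successorSum (Q ∘ suc) X N      ≡⟨ cong (new +_) IH ⟩
  new + (above + below)                ≡⟨ +-comm new _ ⟩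
  above + below + new                  ≡⟨ +-assoc above below new ⟩
  groupedSum Q (true ∷ X) (suc N)      ∎
  where
  new   = Q (suc (length X)) (suc (count id X))
  above = ∑[ t < N ∸ length X ] Q (suc (length X + t)) 0
  below = ∑[ t < count id X ] Q (suc (length X)) (suc t)

successorSum≡groupedSum : ∀ Q X k N → FalseFrom k X → k ≤ N → successorSum Q X N ≡ groupedSum Q X N
successorSum≡groupedSum Q []      k       N       _         _   = trans
  (∑-cong N λ v _ → cong₂ Q (length-replicate v) (count-FalseFrom-zero _ (FalseFrom-replicate 0 v)))
  (sym (+-identityʳ _))
successorSum≡groupedSum Q (x ∷ X) zero    zero    all       _   =
  cong (λ h → ∑[ t < h ] Q (suc (length X)) (suc t)) (sym (count-FalseFrom-zero (x ∷ X) all))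
successorSum≡groupedSum Q (x ∷ X) zero    (suc N) (_ ∷ all) _   =
  successorSum-∷ Q x X N (successorSum≡groupedSum (Q ∘ suc) X zero N all z≤n)
successorSum≡groupedSum Q (x ∷ X) (suc k) (suc N) all       k≤N =
  successorSum-∷ Q x X N (successorSum≡groupedSum (Q ∘ suc) X k N all (s≤s⁻¹ k≤N))

-- After n − r placements only the first n − r + 1 entries of a state can be admissible, so every
-- admissible listed value is below n.
acceptCount≡completions : ∀ n r X → r ≤ n → FalseFrom (suc (n ∸ r)) X →
  acceptCount n X r ≡ completions r (n ∸ length X) (count id X)
acceptCount≡completions n zero    X _   _   = refl
acceptCount≡completions n (suc r) X r<n inv = begin
  acceptCount n X (suc r)
    ≡⟨ acceptCount-suc n X r ⟩
  ∑[ v < n ] (if allowed X v then acceptCount n (advance X v) r else 0)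
    ≡⟨ ∑-cong n (λ v _ → cong (λ z → if allowed X v then z else 0)
         (acceptCount≡completions n r (advance X v) (<⇒≤ r<n) (FalseFrom-forbidBelow (n ∸ r) X v inv′))) ⟩
  successorSum Q X n
    ≡⟨ successorSum≡groupedSum Q X (suc (n ∸ suc r)) n inv (subst (_≤ n) (sym n∸r≡) (m∸n≤m n r)) ⟩
  ∑[ t < E ] completions r (n ∸ suc (L + t)) 1 + ∑[ t < count id X ] completions r (n ∸ suc L) (2 + t)
    ≡⟨ cong₂ _+_ (trans (∑-cong E λ t _ → cong (λ e → completions r e 1) (above t))
                        (∑-reverse E (λ t → completions r t 1)))
                 (∑-cong (count id X) λ t _ → cong (λ e → completions r e (2 + t)) below) ⟩
  completions (suc r) E (count id X) ∎
  where
  L = length X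
  E = n ∸ L
  Q = λ l h → completions r (n ∸ suc l) (suc h)
  n∸r≡ : suc (n ∸ suc r) ≡ n ∸ r
  n∸r≡ = sym (+-∸-assoc 1 r<n)
  inv′ : FalseFrom (n ∸ r) X
  inv′ = subst (λ k → FalseFrom k X) n∸r≡ inv
  above : ∀ t → n ∸ suc (L + t) ≡ E ∸ suc t
  above t = trans (cong (n ∸_) (sym (+-suc L t))) (sym (∸-+-assoc n L (suc t)))
  below : n ∸ suc L ≡ E ∸ 1
  below = trans (cong (n ∸_) (+-comm 1 L)) (sym (∸-+-assoc n L 1))

acceptCount≡bℕ : ∀ n → acceptCount n (true ∷ []) n ≡ bℕ n
acceptCount≡bℕ n = trans (acceptCount≡completions n n (true ∷ []) ≤-refl initial) (completions≡bℕ n)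
  where
  initial : FalseFrom (suc (n ∸ n)) (true ∷ [])
  initial = subst (λ k → FalseFrom (suc k) (true ∷ [])) (sym (n∸n≡0 n)) []

≤ᵇ-suc : ∀ v u → (suc v ≤ᵇ suc u) ≡ (v ≤ᵇ u)
≤ᵇ-suc zero    u = refl
≤ᵇ-suc (suc v) u = refl

allowed-forbidBelow : ∀ X v u → allowed (forbidBelow X v) u ≡ allowed X u ∧ (v ≤ᵇ u)
allowed-forbidBelow []      zero    u       = refl
allowed-forbidBelow []      (suc v) zero    = refl
allowed-forbidBelow []      (suc v) (suc u) = trans (allowed-forbidBelow [] v u) (sym (≤ᵇ-suc v u))
allowed-forbidBelow (x ∷ X) zero    u       = sym (∧-identityʳ (allowed (x ∷ X) u))
allowed-forbidBelow (x ∷ X) (suc v) zero    = sym (∧-zeroʳ x)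
allowed-forbidBelow (x ∷ X) (suc v) (suc u) =
  trans (allowed-forbidBelow X v u) (cong (allowed X u ∧_) (sym (≤ᵇ-suc v u)))

allowed-true∷[] : ∀ w → T (allowed (true ∷ []) w)
allowed-true∷[] zero    = tt
allowed-true∷[] (suc w) = tt

-- With 0-based values, x = f(i) forbids y = f(i + d): this is f(j) − (j − i) ∈ [1, f(i) − 1].
Blocks : ℕ → ℕ → ℕ → Set
Blocks x d y = d ≤ y × suc y ≤ x + d

≤∸⇔¬Blocks : ∀ v a y → a < y → (v ≤ y ∸ suc a) ⇔ (¬ Blocks v (suc a) y)
≤∸⇔¬Blocks v a y a<y = mk⇔
  (λ v≤ (_ , y<) → <⇒≱ y< (subst (v + suc a ≤_) (m∸n+n≡m a<y) (+-monoˡ-≤ (suc a) v≤)))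
  (λ ¬blocks → m+n≤o⇒m≤o∸n v (≮⇒≥ λ y< → ¬blocks (a<y , y<)))

allowed-advance : ∀ X v a y → a < y →
  T (allowed (advance X v) (y ∸ a)) ⇔ (T (allowed X (y ∸ suc a)) × ¬ Blocks v (suc a) y)
allowed-advance X v a y a<y = mk⇔ to from
  where
  u = y ∸ suc a
  unfold : T (allowed (advance X v) (y ∸ a)) ≡ T (allowed X u ∧ (v ≤ᵇ u))
  unfold = trans (cong (T ∘ allowed (advance X v)) (+-∸-assoc 1 a<y)) (cong T (allowed-forbidBelow X v u))
  to : T (allowed (advance X v) (y ∸ a)) → T (allowed X u) × ¬ Blocks v (suc a) y
  to t with Equivalence.to T-∧ (subst id unfold t)
  ... | ok , v≤ = ok , Equivalence.to (≤∸⇔¬Blocks v a y a<y) (≤ᵇ⇒≤ v u v≤)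
  from : T (allowed X u) × ¬ Blocks v (suc a) y → T (allowed (advance X v) (y ∸ a))
  from (ok , ¬blocks) =
    subst id (sym unfold)
      (Equivalence.from T-∧ (ok , ≤⇒≤ᵇ (Equivalence.from (≤∸⇔¬Blocks v a y a<y) ¬blocks)))

Respects : ∀ {r n} → List Bool → (Fin r → Fin n) → Set
Respects X g = ∀ j → toℕ j ≤ toℕ (g j) → T (allowed X (toℕ (g j) ∸ toℕ j))

Compatible : ∀ {r n} → (Fin r → Fin n) → Set
Compatible g = ∀ i j → i Fin.< j → ¬ Blocks (toℕ (g i)) (toℕ j ∸ toℕ i) (toℕ (g j))

accepts-sound : ∀ {n} r X (g : Fin r → Fin n) → T (accepts r X g) → Respects X g × Compatible g
accepts-sound zero    X g _ = (λ ()) , (λ ())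
accepts-sound (suc r) X g t with Equivalence.to T-∧ t
... | ok₀ , ok = respects , compatible
  where
  g₀ = toℕ (g Fin.zero)
  tail = accepts-sound r (advance X g₀) (g ∘ Fin.suc) ok
  advanced : ∀ j → toℕ j < toℕ (g (Fin.suc j)) →
             T (allowed X (toℕ (g (Fin.suc j)) ∸ suc (toℕ j))) × ¬ Blocks g₀ (suc (toℕ j)) (toℕ (g (Fin.suc j)))
  advanced j j<y = Equivalence.to (allowed-advance X g₀ (toℕ j) _ j<y) (proj₁ tail j (<⇒≤ j<y))
  respects : Respects X g
  respects Fin.zero    _   = ok₀
  respects (Fin.suc j) j<y = proj₁ (advanced j j<y)
  compatible : Compatible g
  compatible Fin.zero    Fin.zero    ()
  compatible Fin.zero    (Fin.suc j) _          blocks = proj₂ (advanced j (proj₁ blocks)) blocks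
  compatible (Fin.suc i) Fin.zero    ()
  compatible (Fin.suc i) (Fin.suc j) (s≤s i<j)  = proj₂ tail i j i<j

accepts-complete : ∀ {n} r X (g : Fin r → Fin n) → Respects X g → Compatible g → T (accepts r X g)
accepts-complete zero    X g _        _          = tt
accepts-complete (suc r) X g respects compatible =
  Equivalence.from T-∧
    (respects Fin.zero z≤n , accepts-complete r (advance X g₀) (g ∘ Fin.suc) respects′ compatible′)
  where
  g₀ = toℕ (g Fin.zero)
  respects′ : Respects (advance X g₀) (g ∘ Fin.suc)
  respects′ j j≤y with m≤n⇒m<n∨m≡n j≤y
  ... | inj₁ j<y  = Equivalence.from (allowed-advance X g₀ (toℕ j) _ j<y)
                      (respects (Fin.suc j) j<y , compatible Fin.zero (Fin.suc j) (s≤s z≤n))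
  ... | inj₂ j≡y  = subst (T ∘ allowed (advance X g₀)) (sym (trans (cong (_∸ toℕ j) (sym j≡y)) (n∸n≡0 (toℕ j)))) tt
  compatible′ : Compatible (g ∘ Fin.suc)
  compatible′ i j i<j = compatible (Fin.suc i) (Fin.suc j) (s≤s i<j)

accepts⇔Compatible : ∀ {n} (f : Fin n → Fin n) → T (accepts n (true ∷ []) f) ⇔ Compatible f
accepts⇔Compatible {n} f = mk⇔
  (proj₂ ∘ accepts-sound n (true ∷ []) f)
  (accepts-complete n (true ∷ []) f (λ j _ → allowed-true∷[] (toℕ (f j) ∸ toℕ j)))

-- The condition of the theorem over ℕ

ℤ-+-cancelʳ-≤ : ∀ r {p q} → p ℤ.+ r ℤ.≤ q ℤ.+ r → p ℤ.≤ q
ℤ-+-cancelʳ-≤ r {p} {q} le = subst₂ ℤ._≤_ (undo p r) (undo q r) (ℤP.+-monoˡ-≤ (ℤ.- r) le)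
  where undo : ∀ p r → p ℤ.+ r ℤ.+ ℤ.- r ≡ p
        undo = ℤ-Solver.solve-∀

module _ {i j : ℕ} (x y : ℕ) (i≤j : i ≤ j) where

  private
    gap = ℤ.+ suc y ℤ.- (ℤ.+ suc j ℤ.- ℤ.+ suc i)

    gap+j : gap ℤ.+ ℤ.+ j ≡ ℤ.+ suc (y + i)
    gap+j = trans (rearrange (ℤ.+ i) (ℤ.+ j) (ℤ.+ y)) (cong (λ z → ℤ.+ 1 ℤ.+ z) (sym (ℤP.pos-+ y i)))
      where rearrange : ∀ I J Y → ℤ.+ 1 ℤ.+ Y ℤ.- (ℤ.+ 1 ℤ.+ J ℤ.- (ℤ.+ 1 ℤ.+ I)) ℤ.+ J ≡ ℤ.+ 1 ℤ.+ (Y ℤ.+ I)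
            rearrange = ℤ-Solver.solve-∀

    x-1+j : ℤ.+ suc x ℤ.- ℤ.+ 1 ℤ.+ ℤ.+ j ≡ ℤ.+ (x + j)
    x-1+j = trans (rearrange (ℤ.+ x) (ℤ.+ j)) (sym (ℤP.pos-+ x j))
      where rearrange : ∀ X J → ℤ.+ 1 ℤ.+ X ℤ.- ℤ.+ 1 ℤ.+ J ≡ X ℤ.+ J
            rearrange = ℤ-Solver.solve-∀

    j≡ : j ≡ j ∸ i + i
    j≡ = sym (m∸n+n≡m i≤j)

    x+j≡ : x + j ≡ x + (j ∸ i) + i
    x+j≡ = trans (cong (x +_) j≡) (sym (+-assoc x (j ∸ i) i))

    lower⇔ : (ℤ.+ 1 ℤ.≤ gap) ⇔ (j ∸ i ≤ y)
    lower⇔ = mk⇔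
      (λ 1≤gap → m≤n+o⇒m∸n≤o j i (subst (j ≤_) (+-comm y i)
                 (s≤s⁻¹ (ℤP.drop‿+≤+ (subst (ℤ.+ suc j ℤ.≤_) gap+j (ℤP.+-monoˡ-≤ (ℤ.+ j) 1≤gap))))))
      (λ d≤y → ℤ-+-cancelʳ-≤ (ℤ.+ j) (subst (ℤ.+ suc j ℤ.≤_) (sym gap+j)
                 (ℤ.+≤+ (s≤s (subst (_≤ y + i) (sym j≡) (+-monoˡ-≤ i d≤y))))))

    upper⇔ : (gap ℤ.≤ ℤ.+ suc x ℤ.- ℤ.+ 1) ⇔ (suc y ≤ x + (j ∸ i))
    upper⇔ = mk⇔
      (λ gap≤ → +-cancelʳ-≤ i (suc y) (x + (j ∸ i)) (subst (suc (y + i) ≤_) x+j≡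
                 (ℤP.drop‿+≤+ (subst₂ ℤ._≤_ gap+j x-1+j (ℤP.+-monoˡ-≤ (ℤ.+ j) gap≤)))))
      (λ y< → ℤ-+-cancelʳ-≤ (ℤ.+ j) (subst₂ ℤ._≤_ (sym gap+j) (sym x-1+j)
                 (ℤ.+≤+ (subst (suc (y + i) ≤_) (sym x+j≡) (+-monoˡ-≤ i y<)))))

  bounds⇔Blocks : (ℤ.+ 1 ℤ.≤ gap × gap ℤ.≤ ℤ.+ suc x ℤ.- ℤ.+ 1) ⇔ Blocks x (j ∸ i) y
  bounds⇔Blocks = mk⇔
    (λ (l , u) → Equivalence.to lower⇔ l , Equivalence.to upper⇔ u)
    (λ (l , u) → Equivalence.from lower⇔ l , Equivalence.from upper⇔ u)

Good⇔Compatible : ∀ n (f : Fin n → Fin n) → Good n f ⇔ Compatible f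
Good⇔Compatible n f = mk⇔
  (λ good i j i<j blocks → good i j i<j (Equivalence.from (bounds⇔Blocks _ _ (<⇒≤ i<j)) blocks))
  (λ compatible i j i<j bounds → compatible i j i<j (Equivalence.to (bounds⇔Blocks _ _ (<⇒≤ i<j)) bounds))

countGood≡acceptCount : ∀ n → countGood n ≡ acceptCount n (true ∷ []) n
countGood≡acceptCount n = trans (length-filter (good? n) (allFuns n n)) (count-cong decide (allFuns n n))
  where
  decide : ∀ f → does (good? n f) ≡ accepts n (true ∷ []) f
  decide f = does-⇔ (⇔-sym (accepts⇔Compatible f) ⇔-∘ Good⇔Compatible n f) (good? n f) (T? _)

open import Data.Integer using (+_)

theorem1 : (n : ℕ) → b n ≡ (+ countGood n) / 1
theorem1 n = begin
  b n                                  ≡⟨ b≡fromℕ n ⟩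
  fromℕ (bℕ n)                         ≡⟨ cong fromℕ (acceptCount≡bℕ n) ⟨
  fromℕ (acceptCount n (true ∷ []) n)  ≡⟨ cong fromℕ (countGood≡acceptCount n) ⟨
  fromℕ (countGood n)                  ∎
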